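{- Let $H$ be a hypergraph, $i\in V(H)$ and $e\in E(H)$. Then: (i) $\eta_H(\mathbf{x})=\eta_{H\setminus e}(\mathbf{x})-\sum_{S\subseteq e,\,|S|>1}(|S|-1)\,\eta_{(H\setminus e)\setminus S}(\mathbf{x})$; (ii) $\eta_H(\mathbf{x})=x_i\,\eta_{H\setminus i}(\mathbf{x})-\sum_{e'\in I_H(i)}\sum_{S\subseteq e',\,i\in S,\,|S|>1}(|S|-1)\,\eta_{(H\setminus e')\setminus S}(\mathbf{x})$; (iii) $\eta_{H_1\sqcup H_2}(\mathbf{x})=\eta_{H_1}(\mathbf{x})\,\eta_{H_2}(\mathbf{x})$ for hypergraphs $H_1,H_2$ on disjoint vertex sets; (iv) $\partial_i\eta_H(\mathbf{x})=\eta_{H\setminus i}(\mathbf{x})$.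
   Context: A hypergraph $H$ has a finite vertex set $V(H)$ and a finite family $E(H)$ of subsets of $V(H)$ (edges). A relaxed matching $M$ is a family $(S_f)_{f\in E}$ with $E\subseteq E(H)$, $S_f\subseteq f$, $|S_f|>1$, $S_f\cap S_{f'}=\emptyset$ for distinct $f,f'\in E$; $|M|=|E|$, $V(M)=\bigcup S_f$, $W(M)=\prod_{f\in E}(|S_f|-1)$. The multivariate relaxed matching polynomial is $\eta_H(\mathbf{x})=\sum_M(-1)^{|M|}W(M)\prod_{j\in V(H)\setminus V(M)}x_j$ over all relaxed matchings (variables indexed by vertices). The (weak) vertex deletion $H\setminus i$ has vertex set $V(H)\setminus\{i\}$ and edges $\{f\cap(V(H)\setminus\{i\}):f\in E(H)\}$; for $S\subseteq V(H)$, $H\setminus S$ denotes successive weak deletion of all vertices of $S$. The edge deletion $H\setminus e$ has vertex set $V(H)$ and edge family $E(H)$ with $e$ removed. $I_H(i)=\{f\in E(H):i\in f\}$. $H_1\sqcup H_2$ is the disjoint union. $\partial_i=\partial/\partial x_i$. -}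

module Defs where

open import Data.Bool using (Bool; true; false; if_then_else_; _∧_)
open import Data.Nat using (ℕ; zero; suc; _∸_; _≡ᵇ_; _<ᵇ_)
open import Data.Integer using (ℤ; +_; -_; _+_; _-_; _*_; 0ℤ; 1ℤ)
open import Data.Fin using (Fin; zero; suc; _≟_)
open import Data.Fin.Subset using (Subset; ∣_∣; _∩_; _∪_; _─_; _⊆_; ⁅_⁆; ⊥) renaming (_-_ to _−ᵥ_)
open import Data.Vec as Vec using (_∷_; [])
open import Data.Vec.Functional as VF using ()
open import Data.Maybe using (Maybe; just; nothing)
open import Data.List as L using (List; []; _∷_; map; concatMap; filterᵇ; upTo; removeAt; _++_; foldr)
open import Data.List.Relation.Unary.All using (All)
open import Relation.Binary.PropositionalEquality using (_≡_)
open import Relation.Nullary using (does)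

allSubsets : ∀ n → List (Subset n)
allSubsets zero    = [] ∷ []
allSubsets (suc n) = concatMap (λ s → (true ∷ s) ∷ (false ∷ s) ∷ []) (allSubsets n)

_⊆ᵇ_ : ∀ {n} → Subset n → Subset n → Bool
S ⊆ᵇ f = ∣ S ─ f ∣ ≡ᵇ 0

bigSubsets : ∀ {n} → Subset n → List (Subset n)
bigSubsets {n} f = filterᵇ (λ S → (S ⊆ᵇ f) ∧ (1 <ᵇ ∣ S ∣)) (allSubsets n)

-- Formal power series in variables x_0 … x_{n-1} with ℤ coefficients
-- (a power series is its coefficient function on exponent vectors);
-- polynomials are the finitely supported ones.

Mono : ℕ → Set
Mono n = Fin n → ℕ

PS : ℕ → Set
PS n = Mono n → ℤ

infix 4 _≈ₚ_
_≈ₚ_ : ∀ {n} → PS n → PS n → Set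
p ≈ₚ q = ∀ α → p α ≡ q α

Σℤ : List ℤ → ℤ
Σℤ = foldr _+_ 0ℤ

eqMono : ∀ {n} → Mono n → Mono n → Bool
eqMono {zero}  a b = true
eqMono {suc n} a b = (a zero ≡ᵇ b zero) ∧ eqMono (λ j → a (suc j)) (λ j → b (suc j))

below : ∀ {n} → Mono n → List (Mono n)
below {zero}  α = α ∷ []
below {suc n} α =
  concatMap (λ k → map (λ β → k VF.∷ β) (below (λ j → α (suc j)))) (upTo (suc (α zero)))

infixl 6 _⊕_ _⊖_
infixl 7 _⊛_

_⊕_ : ∀ {n} → PS n → PS n → PS n
(p ⊕ q) α = p α + q α

_⊖_ : ∀ {n} → PS n → PS n → PS n
(p ⊖ q) α = p α - q α

scale : ∀ {n} → ℕ → PS n → PS n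
scale k p α = + k * p α

_⊛_ : ∀ {n} → PS n → PS n → PS n
(p ⊛ q) α = Σℤ (map (λ β → p β * q (λ j → α j ∸ β j)) (below α))

Σps : ∀ {n} → List (PS n) → PS n
Σps ps α = Σℤ (map (λ p → p α) ps)

χ : ∀ {n} → Subset n → Mono n
χ T j = if Vec.lookup T j then 1 else 0

mono : ∀ {n} → Subset n → PS n
mono T α = if eqMono α (χ T) then 1ℤ else 0ℤ

X : ∀ {n} → Fin n → PS n
X i = mono ⁅ i ⁆

bump : ∀ {n} → Fin n → Mono n → Mono n
bump i α j = if does (j ≟ i) then suc (α j) else α j

∂ : ∀ {n} → Fin n → PS n → PS n
∂ i p α = + suc (α i) * p (bump i α)

-- Hypergraphs on (a vertex subset of) the universe Fin n.
-- The edge family is a list (a family, repetitions allowed).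

record Hypergraph (n : ℕ) : Set where
  constructor hg
  field
    V : Subset n
    E : List (Subset n)
open Hypergraph public

IsHypergraph : ∀ {n} → Hypergraph n → Set
IsHypergraph H = All (λ f → f ⊆ V H) (E H)

-- weak vertex deletion H \ i
_∖ᵥ_ : ∀ {n} → Hypergraph n → Fin n → Hypergraph n
H ∖ᵥ i = hg (V H −ᵥ i) (map (λ f → f ∩ (V H −ᵥ i)) (E H))

_∖ₛ_ : ∀ {n} → Hypergraph n → Subset n → Hypergraph n
H ∖ₛ S = hg (V H ─ S) (map (λ f → f ∩ (V H ─ S)) (E H))

-- edge deletion H \ e (e given by its position in the family)
_∖ₑ_ : ∀ {n} (H : Hypergraph n) → Fin (L.length (E H)) → Hypergraph n
H ∖ₑ e = hg (V H) (removeAt (E H) e)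

-- disjoint union (vertex sets assumed disjoint in the statement)
_⊔_ : ∀ {n} → Hypergraph n → Hypergraph n → Hypergraph n
H₁ ⊔ H₂ = hg (V H₁ ∪ V H₂) (E H₁ ++ E H₂)

-- I_H(i) as the list of edge positions containing i
incident : ∀ {n} (H : Hypergraph n) → Fin n → List (Fin (L.length (E H)))
incident H i = filterᵇ (λ p → Vec.lookup (L.lookup (E H) p) i) (L.allFin (L.length (E H)))

-- Relaxed matchings.  A relaxed matching (S_f)_{f ∈ E} is encoded as a
-- list aligned with E(H): entry `nothing` if f ∉ E, `just S_f` otherwise.

Selection : ℕ → Set
Selection n = List (Maybe (Subset n))

choicesFor : ∀ {n} → Subset n → List (Maybe (Subset n))
choicesFor f = nothing ∷ map just (bigSubsets f)

selections : ∀ {n} → List (Subset n) → List (Selection n)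
selections []       = [] ∷ []
selections (f ∷ fs) = concatMap (λ c → map (c ∷_) (selections fs)) (choicesFor f)

support : ∀ {n} → Selection n → Subset n
support []             = ⊥
support (nothing ∷ M)  = support M
support (just S ∷ M)   = S ∪ support M

pairwiseDisjoint : ∀ {n} → Selection n → Bool
pairwiseDisjoint []            = true
pairwiseDisjoint (nothing ∷ M) = pairwiseDisjoint M
pairwiseDisjoint (just S ∷ M)  = (∣ S ∩ support M ∣ ≡ᵇ 0) ∧ pairwiseDisjoint M

size : ∀ {n} → Selection n → ℕ
size []            = 0
size (nothing ∷ M) = size M
size (just _ ∷ M)  = suc (size M)

weight : ∀ {n} → Selection n → ℕ
weight []            = 1
weight (nothing ∷ M) = weight M
weight (just S ∷ M)  = (∣ S ∣ ∸ 1) Data.Nat.* weight M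

relaxedMatchings : ∀ {n} → Hypergraph n → List (Selection n)
relaxedMatchings H = filterᵇ pairwiseDisjoint (selections (E H))

sign : ℕ → ℤ
sign zero    = 1ℤ
sign (suc k) = - sign k

η : ∀ {n} → Hypergraph n → PS n
η H = Σps (map (λ M → scale (weight M) (λ α → sign (size M) * mono (V H ─ support M) α))
               (relaxedMatchings H))

-- The coefficient of x^α in η_H is a matching sum over the list of edges (η-matchingSum):
-- the first edge f either stays out of the matching or contributes a part S ⊆ f with |S| > 1
-- and weight −(|S| − 1), and the remaining edges are then matched on the vertices outside S
-- (matchingSum, shift). The four identities are properties of matching sums.
-- (i) A matching sum does not depend on the order of the edges, so the edge e may be taken
--     first; the term of its part S is the matching sum of (H ∖ e) ∖ S.
-- (ii) The matchings split into those avoiding i, which give x_i η_{H∖i}, and those in which i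
--     lies in a part S of some edge e′ ∋ i.
-- (iii) The matching sum over a concatenation of edge lists is the iterated matching sum, and
--     monomials with disjoint supports multiply to the monomial of the union.
-- (iv) Matching sums are linear, and ∂_i x^W = [i ∈ W] x^(W ∖ i) for squarefree monomials.
module Submission where

open import Defs
open import Data.Nat using (_∸_)
open import Data.Product using (_×_)
open import Data.Fin using (Fin)
open import Data.Fin.Subset using (_∈_; _∩_; ∣_∣; Empty)
open import Data.Vec using ()
open import Data.List as L using (map; concatMap; filterᵇ; length)

open import Algebra.Bundles using (CommutativeMonoid)
import Algebra.Properties.CommutativeSemigroup as CommSemigroupProps
open import Data.Bool using (Bool; true; false; not; _∧_; _∨_; if_then_else_; T)
open import Data.Bool.Properties using (∧-zeroʳ; ∧-comm; ∧-conicalˡ; ∧-conicalʳ; ∧-commutativeMonoid)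
open import Data.Empty using (⊥-elim)
open import Data.Fin using (zero; suc)
open import Data.Fin.Subset using (Subset; _∪_; _─_; ⊥; ⊤; ∁; ⁅_⁆; _⊆_)
open import Data.Fin.Subset.Properties
  using ( drop-∷-⊆; ⊥⊆; ⊆⊤; ⊆-trans; p─q⊆p; x∈p∪q⁻; ∩-comm; ∩-distribʳ-∪; ∩-distribˡ-∪
        ; ∪-assoc; ∪-comm; ∪-identityˡ; p─⊥≡p; p─q─r≡p─q∪r; p─q─r≡p─r─q )
open import Data.Integer using (ℤ; +_; -_; _+_; _-_; _*_; 0ℤ; 1ℤ)
open import Data.Integer.Properties
  using ( +-identityˡ; +-identityʳ; +-assoc; *-zeroˡ; *-zeroʳ; *-identityˡ; *-comm; *-distribˡ-+
        ; neg-distrib-+; neg-distribˡ-*; pos-*; +-commutativeSemigroup; *-commutativeSemigroup )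
open import Data.Integer.Solver using (module +-*-Solver)
open import Data.List using (List; []; _∷_; _++_; removeAt; upTo; applyUpTo)
open import Data.List.Properties using (map-∘; map-tabulate)
open import Data.List.Relation.Unary.All as All using (All; []; _∷_)
open import Data.Maybe using (just; nothing)
open import Data.Nat using (ℕ; zero; suc; _≡ᵇ_; _<ᵇ_)
open import Data.Nat.Properties using (≡ᵇ⇒≡)
open import Data.Product using (_,_)
open import Data.Sum using ([_,_]′)
open import Data.Vec as V using ([]; _∷_; here; there)
open import Data.Vec.Functional as VF using ()
open import Data.Vec.Properties using (lookup⇒[]=; []=⇒lookup; lookup-zipWith; lookup-replicate)
open import Function using (_∘_)
open import Relation.Binary.PropositionalEquality

open +-*-Solver using (solve; _:+_; _:*_; :-_; _:=_)
module +-Props = CommSemigroupProps +-commutativeSemigroup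
module *-Props = CommSemigroupProps *-commutativeSemigroup
module ∧-Props = CommSemigroupProps (CommutativeMonoid.commutativeSemigroup ∧-commutativeMonoid)

when : Bool → ℤ → ℤ
when b x = if b then x else 0ℤ

∑ : {A : Set} → List A → (A → ℤ) → ℤ
∑ xs f = Σℤ (map f xs)

infix 5 ∑
syntax ∑ xs (λ x → e) = ∑[ x ← xs ] e

when-+ : ∀ b x y → when b (x + y) ≡ when b x + when b y
when-+ true  x y = refl
when-+ false x y = refl

when-* : ∀ b c x → when b (c * x) ≡ c * when b x
when-* true  c x = refl
when-* false c x = sym (*-zeroʳ c)

when-when : ∀ a b x → when a (when b x) ≡ when (a ∧ b) x
when-when true  b x = refl
when-when false b x = refl

when-neg : ∀ b x → when b (- x) ≡ - when b x
when-neg true  x = refl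
when-neg false x = refl

when-0 : ∀ b → when b 0ℤ ≡ 0ℤ
when-0 true  = refl
when-0 false = refl

when-rotate : ∀ a b c x → when a (when b (when c x)) ≡ when c (when (a ∧ b) x)
when-rotate true  true  c x = refl
when-rotate true  false c x = sym (when-0 c)
when-rotate false b     c x = sym (when-0 c)

when-*-when : ∀ a b x y → when a x * when b y ≡ when (a ∧ b) (x * y)
when-*-when true  true  x y = refl
when-*-when true  false x y = *-zeroʳ x
when-*-when false b     x y = refl

module _ {A : Set} where

  ∑-cong : {f g : A → ℤ} (xs : List A) → (∀ x → f x ≡ g x) → ∑ xs f ≡ ∑ xs g
  ∑-cong []       eq = refl
  ∑-cong (x ∷ xs) eq = cong₂ _+_ (eq x) (∑-cong xs eq)

  ∑-zero : {f : A → ℤ} (xs : List A) → (∀ x → f x ≡ 0ℤ) → ∑ xs f ≡ 0ℤ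
  ∑-zero []       eq = refl
  ∑-zero (x ∷ xs) eq = cong₂ _+_ (eq x) (∑-zero xs eq)

  ∑-++ : (f : A → ℤ) (xs ys : List A) → ∑ (xs ++ ys) f ≡ ∑ xs f + ∑ ys f
  ∑-++ f []       ys = sym (+-identityˡ _)
  ∑-++ f (x ∷ xs) ys = trans (cong (_+_ (f x)) (∑-++ f xs ys)) (sym (+-assoc (f x) _ _))

  ∑-+ : (f g : A → ℤ) (xs : List A) → ∑[ x ← xs ] (f x + g x) ≡ ∑ xs f + ∑ xs g
  ∑-+ f g []       = refl
  ∑-+ f g (x ∷ xs) = trans (cong (_+_ (f x + g x)) (∑-+ f g xs))
    (+-Props.interchange (f x) (g x) (∑ xs f) (∑ xs g))

  ∑-*ˡ : (c : ℤ) (f : A → ℤ) (xs : List A) → c * ∑ xs f ≡ ∑[ x ← xs ] (c * f x)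
  ∑-*ˡ c f []       = *-zeroʳ c
  ∑-*ˡ c f (x ∷ xs) = trans (*-distribˡ-+ c (f x) _) (cong (_+_ (c * f x)) (∑-*ˡ c f xs))

  ∑-neg : (f : A → ℤ) (xs : List A) → - ∑ xs f ≡ ∑[ x ← xs ] (- f x)
  ∑-neg f []       = refl
  ∑-neg f (x ∷ xs) = trans (neg-distrib-+ (f x) _) (cong (_+_ (- f x)) (∑-neg f xs))

  ∑-when : (b : Bool) (f : A → ℤ) (xs : List A) → when b (∑ xs f) ≡ ∑[ x ← xs ] when b (f x)
  ∑-when true  f xs = refl
  ∑-when false f xs = sym (∑-zero xs (λ _ → refl))

  ∑-filterᵇ : (p : A → Bool) (f : A → ℤ) (xs : List A) →
    ∑ (filterᵇ p xs) f ≡ ∑[ x ← xs ] when (p x) (f x)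
  ∑-filterᵇ p f []       = refl
  ∑-filterᵇ p f (x ∷ xs) with p x
  ... | true  = cong (_+_ (f x)) (∑-filterᵇ p f xs)
  ... | false = trans (∑-filterᵇ p f xs) (sym (+-identityˡ _))

  ∑-filterᵇ-cong : (p : A → Bool) {f g : A → ℤ} (xs : List A) →
    (∀ x → p x ≡ true → f x ≡ g x) → ∑ (filterᵇ p xs) f ≡ ∑ (filterᵇ p xs) g
  ∑-filterᵇ-cong p {f} {g} xs eq =
    trans (∑-filterᵇ p f xs) (trans (∑-cong xs agree) (sym (∑-filterᵇ p g xs)))
    where
    agree : ∀ x → when (p x) (f x) ≡ when (p x) (g x)
    agree x with p x in px
    ... | true  = eq x px
    ... | false = refl

module _ {A B : Set} where

  ∑-map : (f : A → B) (h : B → ℤ) (xs : List A) → ∑ (map f xs) h ≡ ∑ xs (h ∘ f)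
  ∑-map f h xs = cong Σℤ (sym (map-∘ xs))

  ∑-concatMap : (h : B → ℤ) (F : A → List B) (xs : List A) →
    ∑ (concatMap F xs) h ≡ ∑[ x ← xs ] ∑ (F x) h
  ∑-concatMap h F []       = refl
  ∑-concatMap h F (x ∷ xs) =
    trans (∑-++ h (F x) (concatMap F xs)) (cong (_+_ (∑ (F x) h)) (∑-concatMap h F xs))

  ∑-comm : (h : A → B → ℤ) (xs : List A) (ys : List B) →
    ∑[ x ← xs ] ∑ ys (h x) ≡ ∑[ y ← ys ] ∑[ x ← xs ] h x y
  ∑-comm h []       ys = sym (∑-zero ys (λ _ → refl))
  ∑-comm h (x ∷ xs) ys = trans (cong (_+_ (∑ ys (h x))) (∑-comm h xs ys))
    (sym (∑-+ (h x) (λ y → ∑[ x ← xs ] h x y) ys))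

∑-applyUpTo-zero : ∀ (h : ℕ → ℤ) (f : ℕ → ℕ) m → (∀ k → h (f k) ≡ 0ℤ) →
  ∑ (applyUpTo f m) h ≡ 0ℤ
∑-applyUpTo-zero h f zero    eq = refl
∑-applyUpTo-zero h f (suc m) eq = cong₂ _+_ (eq 0) (∑-applyUpTo-zero h (f ∘ suc) m (λ k → eq (suc k)))

All-removeAt : ∀ {A : Set} {P : A → Set} (xs : List A) (e : Fin (length xs)) →
  All P xs → All P (removeAt xs e)
All-removeAt (x ∷ xs) zero    (px ∷ pxs) = pxs
All-removeAt (x ∷ xs) (suc e) (px ∷ pxs) = px ∷ All-removeAt xs e pxs

nullᵇ : ∀ {n} → Subset n → Bool
nullᵇ S = ∣ S ∣ ≡ᵇ 0

disjointᵇ : ∀ {n} → Subset n → Subset n → Bool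
disjointᵇ S X = nullᵇ (S ∩ X)

infix 4 _⊑_
_⊑_ : ∀ {n} → Subset n → Subset n → Set
X ⊑ W = (X ⊆ᵇ W) ≡ true

nullᵇ-∪ : ∀ {n} (A B : Subset n) → nullᵇ (A ∪ B) ≡ nullᵇ A ∧ nullᵇ B
nullᵇ-∪ []          []          = refl
nullᵇ-∪ (true ∷ A)  (b ∷ B)     = refl
nullᵇ-∪ (false ∷ A) (true ∷ B)  = sym (∧-zeroʳ (nullᵇ A))
nullᵇ-∪ (false ∷ A) (false ∷ B) = nullᵇ-∪ A B

disjointᵇ-comm : ∀ {n} (S X : Subset n) → disjointᵇ S X ≡ disjointᵇ X S
disjointᵇ-comm S X = cong nullᵇ (∩-comm S X)

disjointᵇ-∪ˡ : ∀ {n} (S X C : Subset n) → disjointᵇ (S ∪ X) C ≡ disjointᵇ S C ∧ disjointᵇ X C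
disjointᵇ-∪ˡ S X C = trans (cong nullᵇ (∩-distribʳ-∪ C S X)) (nullᵇ-∪ (S ∩ C) (X ∩ C))

disjointᵇ-∪ʳ : ∀ {n} (C S X : Subset n) → disjointᵇ C (S ∪ X) ≡ disjointᵇ C S ∧ disjointᵇ C X
disjointᵇ-∪ʳ C S X = trans (cong nullᵇ (∩-distribˡ-∪ C S X)) (nullᵇ-∪ (C ∩ S) (C ∩ X))

disjointᵇ-⊥ˡ : ∀ {n} (X : Subset n) → disjointᵇ ⊥ X ≡ true
disjointᵇ-⊥ˡ []      = refl
disjointᵇ-⊥ˡ (x ∷ X) = disjointᵇ-⊥ˡ X

disjointᵇ-⁅⁆ : ∀ {n} (i : Fin n) (X : Subset n) → disjointᵇ ⁅ i ⁆ X ≡ not (V.lookup X i)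
disjointᵇ-⁅⁆ zero    (true ∷ X)  = refl
disjointᵇ-⁅⁆ zero    (false ∷ X) = disjointᵇ-⊥ˡ X
disjointᵇ-⁅⁆ (suc i) (x ∷ X)     = disjointᵇ-⁅⁆ i X

disjointᵇ-exchange : ∀ {n} (S X R : Subset n) →
  disjointᵇ S X ∧ disjointᵇ R (S ∪ X) ≡ disjointᵇ R X ∧ disjointᵇ S (R ∪ X)
disjointᵇ-exchange S X R = begin
  disjointᵇ S X ∧ disjointᵇ R (S ∪ X)
    ≡⟨ cong (disjointᵇ S X ∧_) (disjointᵇ-∪ʳ R S X) ⟩
  disjointᵇ S X ∧ (disjointᵇ R S ∧ disjointᵇ R X)
    ≡⟨ ∧-Props.x∙yz≈z∙yx (disjointᵇ S X) (disjointᵇ R S) (disjointᵇ R X) ⟩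
  disjointᵇ R X ∧ (disjointᵇ R S ∧ disjointᵇ S X)
    ≡⟨ cong (λ b → disjointᵇ R X ∧ (b ∧ disjointᵇ S X)) (disjointᵇ-comm R S) ⟩
  disjointᵇ R X ∧ (disjointᵇ S R ∧ disjointᵇ S X)
    ≡⟨ cong (disjointᵇ R X ∧_) (disjointᵇ-∪ʳ S R X) ⟨
  disjointᵇ R X ∧ disjointᵇ S (R ∪ X)
    ∎
  where open ≡-Reasoning

disjointᵇ-assoc : ∀ {n} (S X Y : Subset n) →
  disjointᵇ X Y ∧ disjointᵇ S (X ∪ Y) ≡ disjointᵇ S X ∧ disjointᵇ (S ∪ X) Y
disjointᵇ-assoc S X Y = begin
  disjointᵇ X Y ∧ disjointᵇ S (X ∪ Y)
    ≡⟨ cong (disjointᵇ X Y ∧_) (disjointᵇ-∪ʳ S X Y) ⟩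
  disjointᵇ X Y ∧ (disjointᵇ S X ∧ disjointᵇ S Y)
    ≡⟨ ∧-Props.x∙yz≈y∙zx (disjointᵇ X Y) (disjointᵇ S X) (disjointᵇ S Y) ⟩
  disjointᵇ S X ∧ (disjointᵇ S Y ∧ disjointᵇ X Y)
    ≡⟨ cong (disjointᵇ S X ∧_) (disjointᵇ-∪ˡ S X Y) ⟨
  disjointᵇ S X ∧ disjointᵇ (S ∪ X) Y
    ∎
  where open ≡-Reasoning

⊆ᵇ-∩ : ∀ {n} (S f U : Subset n) → S ⊆ᵇ (f ∩ U) ≡ (S ⊆ᵇ f) ∧ disjointᵇ S (∁ U)
⊆ᵇ-∩ []          []          []          = refl
⊆ᵇ-∩ (false ∷ S) (false ∷ f) (u ∷ U)     = ⊆ᵇ-∩ S f U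
⊆ᵇ-∩ (false ∷ S) (true ∷ f)  (true ∷ U)  = ⊆ᵇ-∩ S f U
⊆ᵇ-∩ (false ∷ S) (true ∷ f)  (false ∷ U) = ⊆ᵇ-∩ S f U
⊆ᵇ-∩ (true ∷ S)  (false ∷ f) (u ∷ U)     = refl
⊆ᵇ-∩ (true ∷ S)  (true ∷ f)  (true ∷ U)  = ⊆ᵇ-∩ S f U
⊆ᵇ-∩ (true ∷ S)  (true ∷ f)  (false ∷ U) = sym (∧-zeroʳ (S ⊆ᵇ f))

⊑-tail : ∀ {n} x w (X W : Subset n) → (x ∷ X) ⊑ (w ∷ W) → X ⊑ W
⊑-tail true  true  X W p = p
⊑-tail false true  X W p = p
⊑-tail false false X W p = p

⊑⇒⊆ : ∀ {n} (X W : Subset n) → X ⊑ W → X ⊆ W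
⊑⇒⊆ (true ∷ X) (true ∷ W) p here      = here
⊑⇒⊆ (x ∷ X)    (w ∷ W)    p (there m) = there (⊑⇒⊆ X W (⊑-tail x w X W p) m)

⊆⇒⊑ : ∀ {n} (X W : Subset n) → X ⊆ W → X ⊑ W
⊆⇒⊑ []          []          p = refl
⊆⇒⊑ (true ∷ X)  (false ∷ W) p with () ← p (here {xs = X})
⊆⇒⊑ (true ∷ X)  (true ∷ W)  p = ⊆⇒⊑ X W (drop-∷-⊆ p)
⊆⇒⊑ (false ∷ X) (true ∷ W)  p = ⊆⇒⊑ X W (drop-∷-⊆ p)
⊆⇒⊑ (false ∷ X) (false ∷ W) p = ⊆⇒⊑ X W (drop-∷-⊆ p)

⊥⊑ : ∀ {n} (W : Subset n) → ⊥ ⊑ W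
⊥⊑ W = ⊆⇒⊑ ⊥ W ⊥⊆

⊑⊤ : ∀ {n} (X : Subset n) → X ⊑ ⊤
⊑⊤ X = ⊆⇒⊑ X ⊤ ⊆⊤

⊑-trans : ∀ {n} (S f W : Subset n) → S ⊑ f → f ⊑ W → S ⊑ W
⊑-trans S f W p q = ⊆⇒⊑ S W (⊆-trans (⊑⇒⊆ S f p) (⊑⇒⊆ f W q))

∪-⊑ : ∀ {n} (S X W : Subset n) → S ⊑ W → X ⊑ W → S ∪ X ⊑ W
∪-⊑ S X W p q = ⊆⇒⊑ (S ∪ X) W (λ m → [ ⊑⇒⊆ S W p , ⊑⇒⊆ X W q ]′ (x∈p∪q⁻ S X m))

─⊑ : ∀ {n} (W X : Subset n) → W ─ X ⊑ W
─⊑ W X = ⊆⇒⊑ (W ─ X) W (p─q⊆p W X)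

disjointᵇ-⊑ : ∀ {n} (A A′ B B′ : Subset n) → A ⊑ A′ → B ⊑ B′ →
  disjointᵇ A′ B′ ≡ true → disjointᵇ A B ≡ true
disjointᵇ-⊑ []          []           []          []           p q d = refl
disjointᵇ-⊑ (true ∷ A)  (false ∷ A′) (b ∷ B)     (b′ ∷ B′)    () q d
disjointᵇ-⊑ (a ∷ A)     (a′ ∷ A′)    (true ∷ B)  (false ∷ B′) p () d
disjointᵇ-⊑ (a ∷ A)     (true ∷ A′)  (b ∷ B)     (true ∷ B′)  p q ()
disjointᵇ-⊑ (false ∷ A) (false ∷ A′) (false ∷ B) (false ∷ B′) p q d = disjointᵇ-⊑ A A′ B B′ p q d
disjointᵇ-⊑ (false ∷ A) (false ∷ A′) (false ∷ B) (true ∷ B′)  p q d = disjointᵇ-⊑ A A′ B B′ p q d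
disjointᵇ-⊑ (false ∷ A) (false ∷ A′) (true ∷ B)  (true ∷ B′)  p q d = disjointᵇ-⊑ A A′ B B′ p q d
disjointᵇ-⊑ (false ∷ A) (true ∷ A′)  (false ∷ B) (false ∷ B′) p q d = disjointᵇ-⊑ A A′ B B′ p q d
disjointᵇ-⊑ (true ∷ A)  (true ∷ A′)  (false ∷ B) (false ∷ B′) p q d = disjointᵇ-⊑ A A′ B B′ p q d

disjointᵇ-∁─ : ∀ {n} (X W S : Subset n) → X ⊑ W → disjointᵇ X (∁ (W ─ S)) ≡ disjointᵇ S X
disjointᵇ-∁─ []          []          []          X⊑W = refl
disjointᵇ-∁─ (false ∷ X) (true ∷ W)  (true ∷ S)  X⊑W = disjointᵇ-∁─ X W S X⊑W
disjointᵇ-∁─ (false ∷ X) (true ∷ W)  (false ∷ S) X⊑W = disjointᵇ-∁─ X W S X⊑W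
disjointᵇ-∁─ (false ∷ X) (false ∷ W) (true ∷ S)  X⊑W = disjointᵇ-∁─ X W S X⊑W
disjointᵇ-∁─ (false ∷ X) (false ∷ W) (false ∷ S) X⊑W = disjointᵇ-∁─ X W S X⊑W
disjointᵇ-∁─ (true ∷ X)  (true ∷ W)  (true ∷ S)  X⊑W = refl
disjointᵇ-∁─ (true ∷ X)  (true ∷ W)  (false ∷ S) X⊑W = disjointᵇ-∁─ X W S X⊑W

Empty⇒disjointᵇ : ∀ {n} (A B : Subset n) → Empty (A ∩ B) → disjointᵇ A B ≡ true
Empty⇒disjointᵇ []          []          e = refl
Empty⇒disjointᵇ (true ∷ A)  (true ∷ B)  e = ⊥-elim (e (zero , here))
Empty⇒disjointᵇ (true ∷ A)  (false ∷ B) e = Empty⇒disjointᵇ A B (λ (x , m) → e (suc x , there m))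
Empty⇒disjointᵇ (false ∷ A) (b ∷ B)     e = Empty⇒disjointᵇ A B (λ (x , m) → e (suc x , there m))

disjointᵇ-lookup : ∀ {n} (R X : Subset n) i →
  disjointᵇ R X ≡ true → V.lookup R i ≡ true → V.lookup X i ≡ false
disjointᵇ-lookup (true ∷ R)  (false ∷ X) zero    R#X R∋i = refl
disjointᵇ-lookup (true ∷ R)  (false ∷ X) (suc i) R#X R∋i = disjointᵇ-lookup R X i R#X R∋i
disjointᵇ-lookup (false ∷ R) (x ∷ X)     (suc i) R#X R∋i = disjointᵇ-lookup R X i R#X R∋i

lookup-─⁅⁆ : ∀ {n} (S : Subset n) i → V.lookup (S ─ ⁅ i ⁆) i ≡ false
lookup-─⁅⁆ (s ∷ S) zero    = refl
lookup-─⁅⁆ (s ∷ S) (suc i) = lookup-─⁅⁆ S i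

lookup-─ : ∀ {n} (W X : Subset n) i → V.lookup W i ≡ true → V.lookup (W ─ X) i ≡ not (V.lookup X i)
lookup-─ (true ∷ W) (true ∷ X)  zero    W∋i = refl
lookup-─ (true ∷ W) (false ∷ X) zero    W∋i = refl
lookup-─ (w ∷ W)    (x ∷ X)     (suc i) W∋i = lookup-─ W X i W∋i

⁅⁆-∪-─⁅⁆ : ∀ {n} (W : Subset n) i → V.lookup W i ≡ true → ⁅ i ⁆ ∪ (W ─ ⁅ i ⁆) ≡ W
⁅⁆-∪-─⁅⁆ (true ∷ W) zero    W∋i = cong (true ∷_) (trans (∪-identityˡ (W ─ ⊥)) (p─⊥≡p W))
⁅⁆-∪-─⁅⁆ (w ∷ W)    (suc i) W∋i = cong (w ∷_) (⁅⁆-∪-─⁅⁆ W i W∋i)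

∪-─-∪ : ∀ {n} (V₁ V₂ X Y : Subset n) → disjointᵇ V₁ V₂ ≡ true → X ⊑ V₁ → Y ⊑ V₂ →
  (V₁ ∪ V₂) ─ (X ∪ Y) ≡ (V₁ ─ X) ∪ (V₂ ─ Y)
∪-─-∪ []           []           []          []          d p q = refl
∪-─-∪ (true ∷ V₁)  (true ∷ V₂)  X           Y           () p q
∪-─-∪ (true ∷ V₁)  (false ∷ V₂) (x ∷ X)     (true ∷ Y)  d p ()
∪-─-∪ (false ∷ V₁) (v₂ ∷ V₂)    (true ∷ X)  Y           d () q
∪-─-∪ (false ∷ V₁) (false ∷ V₂) (false ∷ X) (true ∷ Y)  d p ()
∪-─-∪ (true ∷ V₁)  (false ∷ V₂) (true ∷ X)  (false ∷ Y) d p q =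
  cong (false ∷_) (∪-─-∪ V₁ V₂ X Y d p q)
∪-─-∪ (true ∷ V₁)  (false ∷ V₂) (false ∷ X) (false ∷ Y) d p q =
  cong (true ∷_) (∪-─-∪ V₁ V₂ X Y d p q)
∪-─-∪ (false ∷ V₁) (true ∷ V₂)  (false ∷ X) (true ∷ Y)  d p q =
  cong (false ∷_) (∪-─-∪ V₁ V₂ X Y d p q)
∪-─-∪ (false ∷ V₁) (true ∷ V₂)  (false ∷ X) (false ∷ Y) d p q =
  cong (true ∷_) (∪-─-∪ V₁ V₂ X Y d p q)
∪-─-∪ (false ∷ V₁) (false ∷ V₂) (false ∷ X) (false ∷ Y) d p q =
  cong (false ∷_) (∪-─-∪ V₁ V₂ X Y d p q)

-- The matching sum

ω : ∀ {n} → Subset n → ℤ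
ω S = - (+ (∣ S ∣ ∸ 1))

ω-* : ∀ {n} (S : Subset n) x → ω S * x ≡ - (+ (∣ S ∣ ∸ 1) * x)
ω-* S x = sym (neg-distribˡ-* (+ (∣ S ∣ ∸ 1)) x)

shift : ∀ {n} → Subset n → (Subset n → ℤ) → Subset n → ℤ
shift S g X = when (disjointᵇ S X) (g (S ∪ X))

matchingSum : ∀ {n} → List (Subset n) → (Subset n → ℤ) → ℤ
matchingSum []       g = g ⊥
matchingSum (f ∷ fs) g = matchingSum fs g + (∑[ S ← bigSubsets f ] ω S * matchingSum fs (shift S g))

∑-bigSubsets-cong : ∀ {n} (f : Subset n) {F G : Subset n → ℤ} → (∀ S → S ⊑ f → F S ≡ G S) →
  ∑ (bigSubsets f) F ≡ ∑ (bigSubsets f) G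
∑-bigSubsets-cong {n} f eq =
  ∑-filterᵇ-cong (λ S → (S ⊆ᵇ f) ∧ (1 <ᵇ ∣ S ∣)) (allSubsets n)
    (λ S big → eq S (∧-conicalˡ _ _ big))

∑-bigSubsets-∩ : ∀ {n} (f U : Subset n) (F : Subset n → ℤ) →
  ∑ (bigSubsets (f ∩ U)) F ≡ ∑[ S ← bigSubsets f ] when (disjointᵇ S (∁ U)) (F S)
∑-bigSubsets-∩ {n} f U F =
  trans (∑-filterᵇ _ F (allSubsets n))
  (trans (∑-cong (allSubsets n) avoid)
    (sym (∑-filterᵇ _ (λ S → when (disjointᵇ S (∁ U)) (F S)) (allSubsets n))))
  where
  avoid : ∀ S → when ((S ⊆ᵇ (f ∩ U)) ∧ (1 <ᵇ ∣ S ∣)) (F S)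
              ≡ when ((S ⊆ᵇ f) ∧ (1 <ᵇ ∣ S ∣)) (when (disjointᵇ S (∁ U)) (F S))
  avoid S = begin
    when ((S ⊆ᵇ (f ∩ U)) ∧ (1 <ᵇ ∣ S ∣)) (F S)
      ≡⟨ cong (λ b → when (b ∧ (1 <ᵇ ∣ S ∣)) (F S)) (⊆ᵇ-∩ S f U) ⟩
    when (((S ⊆ᵇ f) ∧ disjointᵇ S (∁ U)) ∧ (1 <ᵇ ∣ S ∣)) (F S)
      ≡⟨ cong (λ b → when b (F S)) (∧-Props.xy∙z≈xz∙y (S ⊆ᵇ f) _ _) ⟩
    when (((S ⊆ᵇ f) ∧ (1 <ᵇ ∣ S ∣)) ∧ disjointᵇ S (∁ U)) (F S)
      ≡⟨ when-when ((S ⊆ᵇ f) ∧ (1 <ᵇ ∣ S ∣)) _ _ ⟨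
    when ((S ⊆ᵇ f) ∧ (1 <ᵇ ∣ S ∣)) (when (disjointᵇ S (∁ U)) (F S))
      ∎
    where open ≡-Reasoning

∑-bigSubsets-∌ : ∀ {n} (f : Subset n) i (F : Subset n → ℤ) → V.lookup f i ≡ false →
  ∑[ S ← bigSubsets f ] when (V.lookup S i) (F S) ≡ 0ℤ
∑-bigSubsets-∌ f i F f∌i =
  trans (∑-bigSubsets-cong f (λ S S⊑f → cong (λ b → when b (F S)) (S∌i S S⊑f)))
        (∑-zero (bigSubsets f) (λ _ → refl))
  where
  S∌i : ∀ S → S ⊑ f → V.lookup S i ≡ false
  S∌i S S⊑f with V.lookup S i in S∋i
  ... | false = refl
  ... | true  = trans (sym ([]=⇒lookup (⊑⇒⊆ S f S⊑f (lookup⇒[]= i S S∋i)))) f∌i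

matchingSum-cong-⊑ : ∀ {n} (W : Subset n) (fs : List (Subset n)) → All (_⊑ W) fs →
  {g h : Subset n → ℤ} → (∀ X → X ⊑ W → g X ≡ h X) → matchingSum fs g ≡ matchingSum fs h
matchingSum-cong-⊑ W []       []          eq = eq ⊥ (⊥⊑ W)
matchingSum-cong-⊑ W (f ∷ fs) (f⊑W ∷ fs⊑W) eq = cong₂ _+_ (matchingSum-cong-⊑ W fs fs⊑W eq)
  (∑-bigSubsets-cong f λ S S⊑f → cong (ω S *_) (matchingSum-cong-⊑ W fs fs⊑W λ X X⊑W →
    cong (when (disjointᵇ S X)) (eq (S ∪ X) (∪-⊑ S X W (⊑-trans S f W S⊑f f⊑W) X⊑W))))

matchingSum-cong : ∀ {n} (fs : List (Subset n)) {g h : Subset n → ℤ} → (∀ X → g X ≡ h X) →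
  matchingSum fs g ≡ matchingSum fs h
matchingSum-cong fs eq = matchingSum-cong-⊑ ⊤ fs (all⊑⊤ fs) (λ X _ → eq X)
  where
  all⊑⊤ : ∀ fs → All (_⊑ ⊤) fs
  all⊑⊤ []       = []
  all⊑⊤ (f ∷ fs) = ⊑⊤ f ∷ all⊑⊤ fs

matchingSum-*ˡ : ∀ {n} (c : ℤ) (fs : List (Subset n)) (g : Subset n → ℤ) →
  c * matchingSum fs g ≡ matchingSum fs (λ X → c * g X)
matchingSum-*ˡ c []       g = refl
matchingSum-*ˡ c (f ∷ fs) g = trans (*-distribˡ-+ c (matchingSum fs g) _)
  (cong₂ _+_ (matchingSum-*ˡ c fs g) (trans (∑-*ˡ c _ (bigSubsets f)) (∑-cong (bigSubsets f) λ S →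
    trans (*-Props.x∙yz≈y∙xz c (ω S) (matchingSum fs (shift S g)))
      (cong (ω S *_) (trans (matchingSum-*ˡ c fs (shift S g))
        (matchingSum-cong fs λ X → sym (when-* (disjointᵇ S X) c _)))))))

matchingSum-*ʳ : ∀ {n} (c : ℤ) (fs : List (Subset n)) (g : Subset n → ℤ) →
  matchingSum fs g * c ≡ matchingSum fs (λ X → g X * c)
matchingSum-*ʳ c fs g = trans (*-comm (matchingSum fs g) c)
  (trans (matchingSum-*ˡ c fs g) (matchingSum-cong fs (λ X → *-comm c (g X))))

matchingSum-zero : ∀ {n} (fs : List (Subset n)) {g : Subset n → ℤ} → (∀ X → g X ≡ 0ℤ) →
  matchingSum fs g ≡ 0ℤ
matchingSum-zero fs {g} eq = trans (matchingSum-cong fs (λ X → trans (eq X) (sym (*-zeroˡ (g X)))))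
  (sym (matchingSum-*ˡ 0ℤ fs g))

matchingSum-when : ∀ {n} (b : Bool) (fs : List (Subset n)) (g : Subset n → ℤ) →
  when b (matchingSum fs g) ≡ matchingSum fs (λ X → when b (g X))
matchingSum-when true  fs g = refl
matchingSum-when false fs g = sym (matchingSum-zero fs (λ X → refl))

matchingSum-∑ : ∀ {n} {A : Set} (fs : List (Subset n)) (G : A → Subset n → ℤ) (ys : List A) →
  ∑[ y ← ys ] matchingSum fs (G y) ≡ matchingSum fs (λ X → ∑[ y ← ys ] G y X)
matchingSum-∑ []       G ys = refl
matchingSum-∑ (f ∷ fs) G ys =
  trans (∑-+ (λ y → matchingSum fs (G y)) (λ y → ∑[ S ← bigSubsets f ] ω S * matchingSum fs (shift S (G y)))
             ys)
  (cong₂ _+_ (matchingSum-∑ fs G ys)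
    (trans (∑-comm (λ y S → ω S * matchingSum fs (shift S (G y))) ys (bigSubsets f))
      (∑-cong (bigSubsets f) λ S →
        trans (sym (∑-*ˡ (ω S) (λ y → matchingSum fs (shift S (G y))) ys))
          (cong (ω S *_) (trans (matchingSum-∑ fs (λ y → shift S (G y)) ys)
            (matchingSum-cong fs λ X → sym (∑-when (disjointᵇ S X) (λ y → G y (S ∪ X)) ys)))))))

matchingTerm : ∀ {n} → (Subset n → ℤ) → Selection n → ℤ
matchingTerm g M = + weight M * (sign (size M) * g (support M))

disjointTerm : ∀ {n} → (Subset n → ℤ) → Selection n → ℤ
disjointTerm g M = when (pairwiseDisjoint M) (matchingTerm g M)

disjointTerm-just : ∀ {n} (g : Subset n → ℤ) S M →
  disjointTerm g (just S ∷ M) ≡ ω S * disjointTerm (shift S g) M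
disjointTerm-just g S M with disjointᵇ S (support M) | pairwiseDisjoint M
... | true  | true  = trans (cong (_* (- sign (size M) * g (S ∪ support M))) (pos-* (∣ S ∣ ∸ 1) (weight M)))
  (solve 4 (λ a w s G → (a :* w) :* (:- s :* G) := :- a :* (w :* (s :* G))) refl
    (+ (∣ S ∣ ∸ 1)) (+ weight M) (sign (size M)) (g (S ∪ support M)))
... | true  | false = sym (*-zeroʳ (ω S))
... | false | true  = sym (trans (cong (ω S *_) (trans (cong (+ weight M *_) (*-zeroʳ (sign (size M))))
                                                      (*-zeroʳ (+ weight M))))
                               (*-zeroʳ (ω S)))
... | false | false = sym (*-zeroʳ (ω S))

∑-disjointTerm : ∀ {n} (fs : List (Subset n)) (g : Subset n → ℤ) →
  ∑ (selections fs) (disjointTerm g) ≡ matchingSum fs g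
∑-disjointTerm []       g = trans (+-identityʳ _) (trans (*-identityˡ _) (*-identityˡ (g ⊥)))
∑-disjointTerm (f ∷ fs) g =
  trans (∑-concatMap (disjointTerm g) (λ c → map (c ∷_) (selections fs)) (nothing ∷ map just (bigSubsets f)))
  (cong₂ _+_ (trans (∑-map (nothing ∷_) (disjointTerm g) (selections fs)) (∑-disjointTerm fs g))
    (trans (∑-map just _ (bigSubsets f)) (∑-cong (bigSubsets f) withPart)))
  where
  open ≡-Reasoning
  withPart : ∀ S → ∑ (map (just S ∷_) (selections fs)) (disjointTerm g) ≡ ω S * matchingSum fs (shift S g)
  withPart S = begin
    ∑ (map (just S ∷_) (selections fs)) (disjointTerm g)
      ≡⟨ ∑-map (just S ∷_) (disjointTerm g) (selections fs) ⟩
    ∑[ M ← selections fs ] disjointTerm g (just S ∷ M)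
      ≡⟨ ∑-cong (selections fs) (disjointTerm-just g S) ⟩
    ∑[ M ← selections fs ] ω S * disjointTerm (shift S g) M
      ≡⟨ ∑-*ˡ (ω S) _ (selections fs) ⟨
    ω S * ∑ (selections fs) (disjointTerm (shift S g))
      ≡⟨ cong (ω S *_) (∑-disjointTerm fs (shift S g)) ⟩
    ω S * matchingSum fs (shift S g)
      ∎

η-matchingSum : ∀ {n} (H : Hypergraph n) (α : Mono n) →
  η H α ≡ matchingSum (E H) (λ X → mono (V H ─ X) α)
η-matchingSum H α =
  trans (∑-map _ (λ p → p α) (relaxedMatchings H))
    (trans (∑-filterᵇ pairwiseDisjoint _ (selections (E H)))
           (∑-disjointTerm (E H) (λ X → mono (V H ─ X) α)))

shift-comm : ∀ {n} (S R : Subset n) (g : Subset n → ℤ) X →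
  shift S (shift R g) X ≡ shift R (shift S g) X
shift-comm S R g X = begin
  when (disjointᵇ S X) (when (disjointᵇ R (S ∪ X)) (g (R ∪ (S ∪ X))))
    ≡⟨ when-when (disjointᵇ S X) _ _ ⟩
  when (disjointᵇ S X ∧ disjointᵇ R (S ∪ X)) (g (R ∪ (S ∪ X)))
    ≡⟨ cong₂ when (disjointᵇ-exchange S X R) (cong g (∪-lcomm R S X)) ⟩
  when (disjointᵇ R X ∧ disjointᵇ S (R ∪ X)) (g (S ∪ (R ∪ X)))
    ≡⟨ when-when (disjointᵇ R X) _ _ ⟨
  when (disjointᵇ R X) (when (disjointᵇ S (R ∪ X)) (g (S ∪ (R ∪ X))))
    ∎
  where
  open ≡-Reasoning
  ∪-lcomm : ∀ {n} (R S X : Subset n) → R ∪ (S ∪ X) ≡ S ∪ (R ∪ X)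
  ∪-lcomm R S X = trans (sym (∪-assoc R S X)) (trans (cong (_∪ X) (∪-comm R S)) (∪-assoc S R X))

shift-shift : ∀ {n} (S X : Subset n) (g : Subset n → ℤ) Y →
  shift X (shift S g) Y ≡ when (disjointᵇ S X) (shift (S ∪ X) g Y)
shift-shift S X g Y = begin
  when (disjointᵇ X Y) (when (disjointᵇ S (X ∪ Y)) (g (S ∪ (X ∪ Y))))
    ≡⟨ when-when (disjointᵇ X Y) _ _ ⟩
  when (disjointᵇ X Y ∧ disjointᵇ S (X ∪ Y)) (g (S ∪ (X ∪ Y)))
    ≡⟨ cong₂ when (disjointᵇ-assoc S X Y) (cong g (sym (∪-assoc S X Y))) ⟩
  when (disjointᵇ S X ∧ disjointᵇ (S ∪ X) Y) (g ((S ∪ X) ∪ Y))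
    ≡⟨ when-when (disjointᵇ S X) _ _ ⟨
  when (disjointᵇ S X) (when (disjointᵇ (S ∪ X) Y) (g ((S ∪ X) ∪ Y)))
    ∎
  where open ≡-Reasoning

module _ {n} (fs : List (Subset n)) (g : Subset n → ℤ) where
  private
    oneEdge : Subset n → ℤ
    oneEdge f = ∑[ S ← bigSubsets f ] ω S * matchingSum fs (shift S g)

    twoEdges : Subset n → Subset n → ℤ
    twoEdges a b =
      ∑[ S ← bigSubsets a ] ω S * (∑[ R ← bigSubsets b ] ω R * matchingSum fs (shift R (shift S g)))

    matchingSum-∷∷ : ∀ a b →
      matchingSum (a ∷ b ∷ fs) g ≡ (matchingSum fs g + oneEdge b) + (oneEdge a + twoEdges a b)
    matchingSum-∷∷ a b = cong (_+_ (matchingSum (b ∷ fs) g))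
      (trans (∑-cong (bigSubsets a) (λ S → *-distribˡ-+ (ω S) _ _)) (∑-+ _ _ (bigSubsets a)))

    twoEdges-comm : ∀ a b → twoEdges a b ≡ twoEdges b a
    twoEdges-comm a b =
      trans (∑-cong (bigSubsets a) (λ S → ∑-*ˡ (ω S) _ (bigSubsets b)))
      (trans (∑-comm (λ S R → ω S * (ω R * matchingSum fs (shift R (shift S g))))
                     (bigSubsets a) (bigSubsets b))
      (trans (∑-cong (bigSubsets b) (λ R → ∑-cong (bigSubsets a) (λ S →
         trans (*-Props.x∙yz≈y∙xz (ω S) (ω R) _)
           (cong (λ t → ω R * (ω S * t)) (matchingSum-cong fs (shift-comm R S g))))))
      (sym (∑-cong (bigSubsets b) (λ R → ∑-*ˡ (ω R) _ (bigSubsets a))))))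

  matchingSum-swap : ∀ a b → matchingSum (a ∷ b ∷ fs) g ≡ matchingSum (b ∷ a ∷ fs) g
  matchingSum-swap a b = begin
    matchingSum (a ∷ b ∷ fs) g
      ≡⟨ matchingSum-∷∷ a b ⟩
    (matchingSum fs g + oneEdge b) + (oneEdge a + twoEdges a b)
      ≡⟨ cong (λ t → (matchingSum fs g + oneEdge b) + (oneEdge a + t)) (twoEdges-comm a b) ⟩
    (matchingSum fs g + oneEdge b) + (oneEdge a + twoEdges b a)
      ≡⟨ +-Props.interchange (matchingSum fs g) _ _ _ ⟩
    (matchingSum fs g + oneEdge a) + (oneEdge b + twoEdges b a)
      ≡⟨ matchingSum-∷∷ b a ⟨
    matchingSum (b ∷ a ∷ fs) g
      ∎
    where open ≡-Reasoning

matchingSum-removeAt : ∀ {n} (fs : List (Subset n)) (e : Fin (length fs)) g →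
  matchingSum fs g ≡ matchingSum (L.lookup fs e ∷ removeAt fs e) g
matchingSum-removeAt (f ∷ fs) zero    g = refl
matchingSum-removeAt (f ∷ fs) (suc e) g =
  trans (cong₂ _+_ (matchingSum-removeAt fs e g)
                   (∑-cong (bigSubsets f) (λ S → cong (ω S *_) (matchingSum-removeAt fs e (shift S g)))))
    (matchingSum-swap (removeAt fs e) g f (L.lookup fs e))

matchingSum-++ : ∀ {n} (fs gs : List (Subset n)) g →
  matchingSum (fs ++ gs) g ≡ matchingSum fs (λ X → matchingSum gs (shift X g))
matchingSum-++ []       gs g =
  matchingSum-cong gs (λ Y → sym (cong₂ when (disjointᵇ-⊥ˡ Y) (cong g (∪-identityˡ Y))))
matchingSum-++ (f ∷ fs) gs g = cong₂ _+_ (matchingSum-++ fs gs g)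
  (∑-cong (bigSubsets f) λ S → cong (ω S *_) (trans (matchingSum-++ fs gs (shift S g))
    (matchingSum-cong fs λ X → trans (matchingSum-cong gs (shift-shift S X g))
                                     (sym (matchingSum-when (disjointᵇ S X) gs _)))))

matchingSum-restrict : ∀ {n} (U : Subset n) (fs : List (Subset n)) g →
  matchingSum (map (_∩ U) fs) g ≡ matchingSum fs (λ X → when (disjointᵇ X (∁ U)) (g X))
matchingSum-restrict U []       g = cong (λ b → when b (g ⊥)) (sym (disjointᵇ-⊥ˡ (∁ U)))
matchingSum-restrict U (f ∷ fs) g = cong₂ _+_ (matchingSum-restrict U fs g)
  (trans (∑-bigSubsets-∩ f U _) (∑-cong (bigSubsets f) λ S →
    trans (when-* (disjointᵇ S (∁ U)) (ω S) _) (cong (ω S *_) (begin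
      when (disjointᵇ S (∁ U)) (matchingSum (map (_∩ U) fs) (shift S g))
        ≡⟨ cong (when (disjointᵇ S (∁ U))) (matchingSum-restrict U fs (shift S g)) ⟩
      when (disjointᵇ S (∁ U)) (matchingSum fs (λ X → when (disjointᵇ X (∁ U)) (shift S g X)))
        ≡⟨ matchingSum-when (disjointᵇ S (∁ U)) fs _ ⟩
      matchingSum fs (λ X → when (disjointᵇ S (∁ U)) (when (disjointᵇ X (∁ U)) (shift S g X)))
        ≡⟨ matchingSum-cong fs (λ X →
             trans (when-rotate (disjointᵇ S (∁ U)) (disjointᵇ X (∁ U)) (disjointᵇ S X) (g (S ∪ X)))
                   (cong (λ b → when (disjointᵇ S X) (when b (g (S ∪ X))))
                         (sym (disjointᵇ-∪ˡ S X (∁ U))))) ⟩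
      matchingSum fs (shift S (λ X → when (disjointᵇ X (∁ U)) (g X)))
        ∎))))
  where open ≡-Reasoning

-- Squarefree monomials

bit : Bool → ℕ
bit b = if b then 1 else 0

eqMono-sound : ∀ {n} (a b : Mono n) → eqMono a b ≡ true → ∀ j → a j ≡ b j
eqMono-sound a b eq zero    = ≡ᵇ⇒≡ (a zero) (b zero) (subst T (sym (∧-conicalˡ _ _ eq)) _)
eqMono-sound a b eq (suc j) = eqMono-sound (λ j → a (suc j)) (λ j → b (suc j)) (∧-conicalʳ _ _ eq) j

eqMono-bump : ∀ {n} (i : Fin n) (α : Mono n) (S : Subset n) →
  eqMono (bump i α) (χ S) ≡ V.lookup S i ∧ eqMono α (χ (S ─ ⁅ i ⁆))
eqMono-bump zero    α (true ∷ S)  =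
  cong (λ Y → (α zero ≡ᵇ 0) ∧ eqMono (λ j → α (suc j)) (χ Y)) (sym (p─⊥≡p S))
eqMono-bump zero    α (false ∷ S) = refl
eqMono-bump (suc i) α (s ∷ S)     =
  trans (cong ((α zero ≡ᵇ χ (s ∷ S) zero) ∧_) (eqMono-bump i (λ j → α (suc j)) S))
        (∧-Props.x∙yz≈y∙xz (α zero ≡ᵇ χ (s ∷ S) zero) (V.lookup S i) _)

∂-mono : ∀ {n} (i : Fin n) (S : Subset n) α →
  ∂ i (mono S) α ≡ when (V.lookup S i) (mono (S ─ ⁅ i ⁆) α)
∂-mono i S α rewrite eqMono-bump i α S with V.lookup S i | eqMono α (χ (S ─ ⁅ i ⁆)) in α≡χ
... | false | _     = *-zeroʳ (+ suc (α i))
... | true  | false = *-zeroʳ (+ suc (α i))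
... | true  | true  = cong (λ m → + suc m * 1ℤ) αᵢ≡0
  where
  αᵢ≡0 : α i ≡ 0
  αᵢ≡0 = trans (eqMono-sound α _ α≡χ i) (cong bit (lookup-─⁅⁆ S i))

mono-∷ : ∀ {n} a (A : Subset n) (γ : Mono (suc n)) →
  mono (a ∷ A) γ ≡ when (γ zero ≡ᵇ bit a) (mono A (λ j → γ (suc j)))
mono-∷ a A γ with γ zero ≡ᵇ bit a
... | true  = refl
... | false = refl

-- The coefficient of x^m in x^a · x^b for bits a, b that are not both 1.
∑-upTo-bits : ∀ a b → a ∧ b ≡ false → ∀ m (x : ℤ) →
  ∑[ k ← upTo (suc m) ] when ((k ≡ᵇ bit a) ∧ (m ∸ k ≡ᵇ bit b)) x ≡ when (m ≡ᵇ bit (a ∨ b)) x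
∑-upTo-bits false false _ m x =
  trans (cong (_+_ (when (m ≡ᵇ 0) x)) (∑-applyUpTo-zero _ suc m (λ _ → refl))) (+-identityʳ _)
∑-upTo-bits false true  _ m x =
  trans (cong (_+_ (when (m ≡ᵇ 1) x)) (∑-applyUpTo-zero _ suc m (λ _ → refl))) (+-identityʳ _)
∑-upTo-bits true  false _ zero    x = refl
∑-upTo-bits true  false _ (suc m) x =
  trans (cong (λ t → 0ℤ + (when (m ≡ᵇ 0) x + t))
              (∑-applyUpTo-zero _ (λ (k : ℕ) → suc (suc k)) m (λ _ → refl)))
    (trans (+-identityˡ _) (+-identityʳ _))

mono-⊛ : ∀ {n} (A B : Subset n) → disjointᵇ A B ≡ true → mono A ⊛ mono B ≈ₚ mono (A ∪ B)
mono-⊛ []      []      A#B α = refl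
mono-⊛ (a ∷ A) (b ∷ B) A#B α = begin
  ∑ (below α) product
    ≡⟨ ∑-concatMap product (λ k → map (k VF.∷_) (below α′)) ks ⟩
  ∑[ k ← ks ] ∑ (map (k VF.∷_) (below α′)) product
    ≡⟨ ∑-cong ks (λ k → trans (∑-map (k VF.∷_) product (below α′)) (∑-cong (below α′) (λ β →
         trans (cong₂ _*_ (mono-∷ a A (k VF.∷ β)) (mono-∷ b B (λ j → α j ∸ (k VF.∷ β) j)))
               (when-*-when (k ≡ᵇ bit a) _ (mono A β) _)))) ⟩
  ∑[ k ← ks ] ∑[ β ← below α′ ] when (split k) (mono A β * mono B (λ j → α′ j ∸ β j))
    ≡⟨ ∑-cong ks (λ k → sym (∑-when (split k) _ (below α′))) ⟩
  ∑[ k ← ks ] when (split k) ((mono A ⊛ mono B) α′)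
    ≡⟨ ∑-cong ks (λ k → cong (when (split k)) (mono-⊛ A B (tail# a b A#B) α′)) ⟩
  ∑[ k ← ks ] when (split k) (mono (A ∪ B) α′)
    ≡⟨ ∑-upTo-bits a b (head# a b A#B) (α zero) _ ⟩
  when (α zero ≡ᵇ bit (a ∨ b)) (mono (A ∪ B) α′)
    ≡⟨ mono-∷ (a ∨ b) (A ∪ B) α ⟨
  mono ((a ∷ A) ∪ (b ∷ B)) α
    ∎
  where
  open ≡-Reasoning
  α′ : Mono _
  α′ j = α (suc j)
  ks : List ℕ
  ks = upTo (suc (α zero))
  product : Mono _ → ℤ
  product β = mono (a ∷ A) β * mono (b ∷ B) (λ j → α j ∸ β j)
  split : ℕ → Bool
  split k = (k ≡ᵇ bit a) ∧ (α zero ∸ k ≡ᵇ bit b)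
  head# : ∀ a b → disjointᵇ (a ∷ A) (b ∷ B) ≡ true → a ∧ b ≡ false
  head# false b     _ = refl
  head# true  false _ = refl
  tail# : ∀ a b → disjointᵇ (a ∷ A) (b ∷ B) ≡ true → disjointᵇ A B ≡ true
  tail# false b     A#B = A#B
  tail# true  false A#B = A#B

X⊛mono : ∀ {n} (i : Fin n) (W : Subset n) α →
  (X i ⊛ (λ γ → when (V.lookup W i) (mono (W ─ ⁅ i ⁆) γ))) α ≡ when (V.lookup W i) (mono W α)
X⊛mono i W α with V.lookup W i in W∋i
... | false = ∑-zero (below α) (λ β → *-zeroʳ (mono ⁅ i ⁆ β))
... | true  =
  trans (mono-⊛ ⁅ i ⁆ (W ─ ⁅ i ⁆) (trans (disjointᵇ-⁅⁆ i (W ─ ⁅ i ⁆)) (cong not (lookup-─⁅⁆ W i)))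
                α)
        (cong (λ Y → mono Y α) (⁅⁆-∪-─⁅⁆ W i W∋i))

⊛-cong : ∀ {n} {p p′ q q′ : PS n} → p ≈ₚ p′ → q ≈ₚ q′ → p ⊛ q ≈ₚ p′ ⊛ q′
⊛-cong p≈p′ q≈q′ α = ∑-cong (below α) (λ β → cong₂ _*_ (p≈p′ β) (q≈q′ (λ j → α j ∸ β j)))

⊛-matchingSumʳ : ∀ {n} (p : PS n) (gs : List (Subset n)) (q : Subset n → PS n) α →
  (p ⊛ (λ γ → matchingSum gs (λ Y → q Y γ))) α ≡ matchingSum gs (λ Y → (p ⊛ q Y) α)
⊛-matchingSumʳ p gs q α =
  trans (∑-cong (below α) (λ β → matchingSum-*ˡ (p β) gs (λ Y → q Y (λ j → α j ∸ β j))))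
        (matchingSum-∑ gs (λ β Y → p β * q Y (λ j → α j ∸ β j)) (below α))

⊛-matchingSumˡ : ∀ {n} (fs : List (Subset n)) (p : Subset n → PS n) (q : PS n) α →
  ((λ β → matchingSum fs (λ X → p X β)) ⊛ q) α ≡ matchingSum fs (λ X → (p X ⊛ q) α)
⊛-matchingSumˡ fs p q α =
  trans (∑-cong (below α) (λ β → matchingSum-*ʳ (q (λ j → α j ∸ β j)) fs (λ X → p X β)))
        (matchingSum-∑ fs (λ β X → p X β * q (λ j → α j ∸ β j)) (below α))

η-∖ₛ : ∀ {n} (W : Subset n) (fs : List (Subset n)) (S : Subset n) α → All (_⊑ W) fs →
  η (hg W fs ∖ₛ S) α ≡ matchingSum fs (shift S (λ X → mono (W ─ X) α))
η-∖ₛ W fs S α fs⊑W =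
  trans (η-matchingSum (hg W fs ∖ₛ S) α) (trans (matchingSum-restrict (W ─ S) fs _)
    (matchingSum-cong-⊑ W fs fs⊑W (λ X X⊑W →
      cong₂ when (disjointᵇ-∁─ X W S X⊑W) (cong (λ Y → mono Y α) (p─q─r≡p─q∪r W S X)))))

η-∖ₑ : ∀ {n} (H : Hypergraph n) → All (_⊑ V H) (E H) → (e : Fin (length (E H))) →
  η H ≈ₚ η (H ∖ₑ e) ⊖ Σps (map (λ S → scale (∣ S ∣ ∸ 1) (η ((H ∖ₑ e) ∖ₛ S)))
                                (bigSubsets (L.lookup (E H) e)))
η-∖ₑ H E⊑V e α = begin
  η H α
    ≡⟨ η-matchingSum H α ⟩
  matchingSum (E H) g
    ≡⟨ matchingSum-removeAt (E H) e g ⟩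
  matchingSum rest g + (∑[ S ← bigSubsets edge ] ω S * matchingSum rest (shift S g))
    ≡⟨ cong₂ _+_ (sym (η-matchingSum (H ∖ₑ e) α)) (∑-cong (bigSubsets edge) (λ S →
         trans (ω-* S _) (cong (λ t → - (+ (∣ S ∣ ∸ 1) * t)) (sym (η-∖ₛ (V H) rest S α rest⊑V))))) ⟩
  η (H ∖ₑ e) α + (∑[ S ← bigSubsets edge ] - (+ (∣ S ∣ ∸ 1) * η ((H ∖ₑ e) ∖ₛ S) α))
    ≡⟨ cong (_+_ (η (H ∖ₑ e) α))
         (trans (sym (∑-neg _ (bigSubsets edge))) (cong -_ (sym (∑-map _ _ (bigSubsets edge))))) ⟩
  (η (H ∖ₑ e) ⊖ Σps (map (λ S → scale (∣ S ∣ ∸ 1) (η ((H ∖ₑ e) ∖ₛ S))) (bigSubsets edge))) α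
    ∎
  where
  open ≡-Reasoning
  g : Subset _ → ℤ
  g X = mono (V H ─ X) α
  edge = L.lookup (E H) e
  rest = removeAt (E H) e
  rest⊑V = All-removeAt (E H) e E⊑V

η-∖ᵥ : ∀ {n} (H : Hypergraph n) → All (_⊑ V H) (E H) → (i : Fin n) → V.lookup (V H) i ≡ true →
  ∀ α → η (H ∖ᵥ i) α ≡ matchingSum (E H) (λ X → when (V.lookup (V H ─ X) i) (mono ((V H ─ X) ─ ⁅ i ⁆) α))
η-∖ᵥ H E⊑V i V∋i α =
  trans (η-matchingSum (H ∖ᵥ i) α) (trans (matchingSum-restrict (V H ─ ⁅ i ⁆) (E H) _)
    (matchingSum-cong-⊑ (V H) (E H) E⊑V (λ X X⊑V →
      cong₂ when (trans (trans (disjointᵇ-∁─ X (V H) ⁅ i ⁆ X⊑V) (disjointᵇ-⁅⁆ i X))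
                        (sym (lookup-─ (V H) X i V∋i)))
                 (cong (λ Y → mono Y α) (p─q─r≡p─r─q (V H) ⁅ i ⁆ X)))))

η-∂ : ∀ {n} (H : Hypergraph n) → All (_⊑ V H) (E H) → (i : Fin n) → V.lookup (V H) i ≡ true →
  ∂ i (η H) ≈ₚ η (H ∖ᵥ i)
η-∂ H E⊑V i V∋i α = begin
  + suc (α i) * η H (bump i α)
    ≡⟨ cong (+ suc (α i) *_) (η-matchingSum H (bump i α)) ⟩
  + suc (α i) * matchingSum (E H) (λ X → mono (V H ─ X) (bump i α))
    ≡⟨ matchingSum-*ˡ (+ suc (α i)) (E H) _ ⟩
  matchingSum (E H) (λ X → ∂ i (mono (V H ─ X)) α)
    ≡⟨ matchingSum-cong (E H) (λ X → ∂-mono i (V H ─ X) α) ⟩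
  matchingSum (E H) (λ X → when (V.lookup (V H ─ X) i) (mono ((V H ─ X) ─ ⁅ i ⁆) α))
    ≡⟨ η-∖ᵥ H E⊑V i V∋i α ⟨
  η (H ∖ᵥ i) α
    ∎
  where open ≡-Reasoning

η-⊔ : ∀ {n} (H₁ H₂ : Hypergraph n) → All (_⊑ V H₁) (E H₁) → All (_⊑ V H₂) (E H₂) →
  disjointᵇ (V H₁) (V H₂) ≡ true → η (H₁ ⊔ H₂) ≈ₚ η H₁ ⊛ η H₂
η-⊔ {n} H₁ H₂ E₁⊑V₁ E₂⊑V₂ V₁#V₂ α = begin
  η (H₁ ⊔ H₂) α
    ≡⟨ η-matchingSum (H₁ ⊔ H₂) α ⟩
  matchingSum (E H₁ ++ E H₂) G
    ≡⟨ matchingSum-++ (E H₁) (E H₂) G ⟩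
  matchingSum (E H₁) (λ X → matchingSum (E H₂) (shift X G))
    ≡⟨ matchingSum-cong-⊑ (V H₁) (E H₁) E₁⊑V₁ (λ X X⊑V₁ →
         matchingSum-cong-⊑ (V H₂) (E H₂) E₂⊑V₂ (λ Y Y⊑V₂ → disjointParts X Y X⊑V₁ Y⊑V₂)) ⟩
  matchingSum (E H₁) (λ X → matchingSum (E H₂) (λ Y → (m₁ X ⊛ m₂ Y) α))
    ≡⟨ matchingSum-cong (E H₁) (λ X → ⊛-matchingSumʳ (m₁ X) (E H₂) m₂ α) ⟨
  matchingSum (E H₁) (λ X → (m₁ X ⊛ η₂) α)
    ≡⟨ ⊛-matchingSumˡ (E H₁) m₁ η₂ α ⟨
  (η₁ ⊛ η₂) α
    ≡⟨ ⊛-cong (η-matchingSum H₁) (η-matchingSum H₂) α ⟨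
  (η H₁ ⊛ η H₂) α
    ∎
  where
  open ≡-Reasoning
  m₁ m₂ : Subset n → PS n
  m₁ X = mono (V H₁ ─ X)
  m₂ Y = mono (V H₂ ─ Y)
  η₁ η₂ : PS n
  η₁ β = matchingSum (E H₁) (λ X → m₁ X β)
  η₂ γ = matchingSum (E H₂) (λ Y → m₂ Y γ)
  G : Subset n → ℤ
  G Z = mono ((V H₁ ∪ V H₂) ─ Z) α
  disjointParts : ∀ X Y → X ⊑ V H₁ → Y ⊑ V H₂ → shift X G Y ≡ (m₁ X ⊛ m₂ Y) α
  disjointParts X Y X⊑V₁ Y⊑V₂ =
    trans (cong₂ when (disjointᵇ-⊑ X (V H₁) Y (V H₂) X⊑V₁ Y⊑V₂ V₁#V₂)
                      (cong (λ Z → mono Z α) (∪-─-∪ (V H₁) (V H₂) X Y V₁#V₂ X⊑V₁ Y⊑V₂)))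
      (sym (mono-⊛ (V H₁ ─ X) (V H₂ ─ Y)
             (disjointᵇ-⊑ (V H₁ ─ X) (V H₁) (V H₂ ─ Y) (V H₂) (─⊑ (V H₁) X) (─⊑ (V H₂) Y) V₁#V₂) α))

module Cover {n} (i : Fin n) where

  avoiding : (Subset n → ℤ) → Subset n → ℤ
  avoiding g X = when (not (V.lookup X i)) (g X)

  coverTerm : List (Subset n) → (Subset n → ℤ) → Subset n → ℤ
  coverTerm fs g S = when (V.lookup S i) (ω S * matchingSum fs (shift S g))

  -- The matchings in which i lies in a part S of the edge at position p.
  covering : List (Subset n) → (Subset n → ℤ) → ℤ
  covering fs g =
    ∑[ p ← L.allFin (length fs) ] ∑ (bigSubsets (L.lookup fs p)) (coverTerm (removeAt fs p) g)

  -- Matchings with a part R of the edge f and a part S ∋ i of the edge at position q.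
  crossing : Subset n → List (Subset n) → (Subset n → ℤ) → ℤ
  crossing f fs g = ∑[ q ← L.allFin (length fs) ] ∑[ S ← bigSubsets (L.lookup fs q) ]
    when (V.lookup S i)
         (ω S * (∑[ R ← bigSubsets f ] ω R * matchingSum (removeAt fs q) (shift R (shift S g))))

  avoiding-shift : ∀ fs g R → matchingSum fs (avoiding (shift R g))
    ≡ matchingSum fs (shift R (avoiding g)) + when (V.lookup R i) (matchingSum fs (shift R g))
  avoiding-shift fs g R with V.lookup R i in R∋i
  ... | true  = trans (matchingSum-cong fs avoided)
                      (sym (trans (cong (_+ matchingSum fs (shift R g)) (matchingSum-zero fs killed))
                                  (+-identityˡ _)))
    where
    avoided : ∀ X → avoiding (shift R g) X ≡ shift R g X
    avoided X with disjointᵇ R X in R#X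
    ... | true  = cong (λ b → when (not b) (g (R ∪ X))) (disjointᵇ-lookup R X i R#X R∋i)
    ... | false = when-0 (not (V.lookup X i))
    killed : ∀ X → shift R (avoiding g) X ≡ 0ℤ
    killed X = trans (cong (λ b → when (disjointᵇ R X) (when (not b) (g (R ∪ X))))
                           (trans (lookup-zipWith _∨_ i R X) (cong (_∨ V.lookup X i) R∋i)))
                     (when-0 (disjointᵇ R X))
  ... | false = trans (matchingSum-cong fs commute) (sym (+-identityʳ _))
    where
    commute : ∀ X → avoiding (shift R g) X ≡ shift R (avoiding g) X
    commute X = begin
      when (not (V.lookup X i)) (when (disjointᵇ R X) (g (R ∪ X)))
        ≡⟨ when-when (not (V.lookup X i)) _ _ ⟩
      when (not (V.lookup X i) ∧ disjointᵇ R X) (g (R ∪ X))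
        ≡⟨ cong (λ b → when b (g (R ∪ X))) (∧-comm (not (V.lookup X i)) _) ⟩
      when (disjointᵇ R X ∧ not (V.lookup X i)) (g (R ∪ X))
        ≡⟨ cong (λ b → when (disjointᵇ R X ∧ not b) (g (R ∪ X)))
             (sym (trans (lookup-zipWith _∨_ i R X) (cong (_∨ V.lookup X i) R∋i))) ⟩
      when (disjointᵇ R X ∧ not (V.lookup (R ∪ X) i)) (g (R ∪ X))
        ≡⟨ when-when (disjointᵇ R X) _ _ ⟨
      shift R (avoiding g) X
        ∎
      where open ≡-Reasoning

  covering-∷ : ∀ f fs g →
    covering (f ∷ fs) g ≡ ∑ (bigSubsets f) (coverTerm fs g) + (covering fs g + crossing f fs g)
  covering-∷ f fs g = cong (_+_ (∑ (bigSubsets f) (coverTerm fs g))) (begin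
    ∑ (L.tabulate suc) G
      ≡⟨ cong (λ ps → ∑ ps G) (sym (map-tabulate (λ q → q) suc)) ⟩
    ∑ (map suc (L.allFin (length fs))) G
      ≡⟨ ∑-map suc G (L.allFin (length fs)) ⟩
    ∑[ q ← L.allFin (length fs) ] ∑ (bigSubsets (L.lookup fs q)) (coverTerm (f ∷ removeAt fs q) g)
      ≡⟨ ∑-cong (L.allFin (length fs)) (λ q → trans
           (∑-cong (bigSubsets (L.lookup fs q)) (λ S →
              trans (cong (when (V.lookup S i)) (*-distribˡ-+ (ω S) _ _)) (when-+ (V.lookup S i) _ _)))
           (∑-+ _ _ (bigSubsets (L.lookup fs q)))) ⟩
    ∑[ q ← L.allFin (length fs) ] (∑ (bigSubsets (L.lookup fs q)) (coverTerm (removeAt fs q) g) + _)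
      ≡⟨ ∑-+ _ _ (L.allFin (length fs)) ⟩
    covering fs g + crossing f fs g
      ∎)
    where
    open ≡-Reasoning
    G : Fin (length (f ∷ fs)) → ℤ
    G p = ∑ (bigSubsets (L.lookup (f ∷ fs) p)) (coverTerm (removeAt (f ∷ fs) p) g)

  ∑-ω-covering : ∀ f fs g → ∑[ R ← bigSubsets f ] ω R * covering fs (shift R g) ≡ crossing f fs g
  ∑-ω-covering f fs g =
    trans (∑-cong (bigSubsets f) (λ R → trans (∑-*ˡ (ω R) _ (L.allFin (length fs)))
             (∑-cong (L.allFin (length fs)) (λ q → ∑-*ˡ (ω R) _ (bigSubsets (L.lookup fs q))))))
    (trans (∑-comm _ (bigSubsets f) (L.allFin (length fs)))
    (∑-cong (L.allFin (length fs)) λ q →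
      trans (∑-comm _ (bigSubsets f) (bigSubsets (L.lookup fs q)))
      (∑-cong (bigSubsets (L.lookup fs q)) λ S →
        trans (∑-cong (bigSubsets f) (λ R → exchange q S R))
          (trans (sym (∑-when (V.lookup S i) _ (bigSubsets f)))
            (cong (when (V.lookup S i)) (sym (∑-*ˡ (ω S) _ (bigSubsets f))))))))
    where
    exchange : ∀ q S R → ω R * coverTerm (removeAt fs q) (shift R g) S
      ≡ when (V.lookup S i) (ω S * (ω R * matchingSum (removeAt fs q) (shift R (shift S g))))
    exchange q S R =
      trans (sym (when-* (V.lookup S i) (ω R) _))
        (cong (when (V.lookup S i)) (trans (*-Props.x∙yz≈y∙xz (ω R) (ω S) _)
          (cong (λ t → ω S * (ω R * t)) (matchingSum-cong (removeAt fs q) (shift-comm S R g)))))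

  matchingSum-avoiding : ∀ fs g → matchingSum fs g ≡ matchingSum fs (avoiding g) + covering fs g
  matchingSum-avoiding []       g =
    trans (cong (λ b → when (not b) (g ⊥)) (sym (lookup-replicate i false))) (sym (+-identityʳ _))
  matchingSum-avoiding (f ∷ fs) g = begin
    matchingSum fs g + (∑[ R ← bigSubsets f ] ω R * matchingSum fs (shift R g))
      ≡⟨ cong₂ _+_ (matchingSum-avoiding fs g) (∑-cong (bigSubsets f) (λ R →
           trans (cong (ω R *_) (matchingSum-avoiding fs (shift R g))) (*-distribˡ-+ (ω R) _ _))) ⟩
    (a + q) + (∑[ R ← bigSubsets f ]
                 (ω R * matchingSum fs (avoiding (shift R g)) + ω R * covering fs (shift R g)))
      ≡⟨ cong (_+_ (a + q)) (trans (∑-+ _ _ (bigSubsets f)) (cong₂ _+_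
           (trans (∑-cong (bigSubsets f) split) (∑-+ _ _ (bigSubsets f)))
           (∑-ω-covering f fs g))) ⟩
    (a + q) + ((b + c) + d)
      ≡⟨ solve 5 (λ a q b c d → (a :+ q) :+ ((b :+ c) :+ d) := (a :+ b) :+ (c :+ (q :+ d)))
               refl a q b c d ⟩
    (a + b) + (c + (q + d))
      ≡⟨ cong (_+_ (a + b)) (covering-∷ f fs g) ⟨
    matchingSum (f ∷ fs) (avoiding g) + covering (f ∷ fs) g
      ∎
    where
    open ≡-Reasoning
    a = matchingSum fs (avoiding g)
    q = covering fs g
    b = ∑[ R ← bigSubsets f ] ω R * matchingSum fs (shift R (avoiding g))
    c = ∑ (bigSubsets f) (coverTerm fs g)
    d = crossing f fs g
    split : ∀ R → ω R * matchingSum fs (avoiding (shift R g))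
                ≡ ω R * matchingSum fs (shift R (avoiding g)) + coverTerm fs g R
    split R = trans (cong (ω R *_) (avoiding-shift fs g R))
      (trans (*-distribˡ-+ (ω R) _ _) (cong (_+_ (ω R * matchingSum fs (shift R (avoiding g))))
        (sym (when-* (V.lookup R i) (ω R) _))))

η-vertex : ∀ {n} (H : Hypergraph n) → All (_⊑ V H) (E H) → (i : Fin n) → V.lookup (V H) i ≡ true →
  η H ≈ₚ X i ⊛ η (H ∖ᵥ i)
         ⊖ Σps (concatMap (λ e′ → map (λ S → scale (∣ S ∣ ∸ 1) (η ((H ∖ₑ e′) ∖ₛ S)))
                                       (filterᵇ (λ S → V.lookup S i) (bigSubsets (L.lookup (E H) e′))))
                          (incident H i))
η-vertex H E⊑V i V∋i α = begin
  η H α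
    ≡⟨ η-matchingSum H α ⟩
  matchingSum (E H) g
    ≡⟨ matchingSum-avoiding (E H) g ⟩
  matchingSum (E H) (avoiding g) + covering (E H) g
    ≡⟨ cong₂ _+_ avoidingPart coveringPart ⟩
  (X i ⊛ η (H ∖ᵥ i)) α - Σps (concatMap F (incident H i)) α
    ∎
  where
  open ≡-Reasoning
  open Cover i
  g : Subset _ → ℤ
  g X = mono (V H ─ X) α
  F : Fin (length (E H)) → List (PS _)
  F p = map (λ S → scale (∣ S ∣ ∸ 1) (η ((H ∖ₑ p) ∖ₛ S)))
            (filterᵇ (λ S → V.lookup S i) (bigSubsets (L.lookup (E H) p)))
  Y : Fin (length (E H)) → ℤ
  Y p = ∑[ S ← bigSubsets (L.lookup (E H) p) ]
          when (V.lookup S i) (+ (∣ S ∣ ∸ 1) * matchingSum (removeAt (E H) p) (shift S g))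

  h : Subset _ → PS _
  h Z γ = when (V.lookup (V H ─ Z) i) (mono ((V H ─ Z) ─ ⁅ i ⁆) γ)

  avoidingPart : matchingSum (E H) (avoiding g) ≡ (X i ⊛ η (H ∖ᵥ i)) α
  avoidingPart = sym (begin
    (X i ⊛ η (H ∖ᵥ i)) α
      ≡⟨ ⊛-cong {p = X i} (λ _ → refl) (η-∖ᵥ H E⊑V i V∋i) α ⟩
    (X i ⊛ (λ γ → matchingSum (E H) (λ Z → h Z γ))) α
      ≡⟨ ⊛-matchingSumʳ (X i) (E H) h α ⟩
    matchingSum (E H) (λ Z → (X i ⊛ h Z) α)
      ≡⟨ matchingSum-cong (E H) (λ Z → trans (X⊛mono i (V H ─ Z) α)
           (cong (λ b → when b (g Z)) (lookup-─ (V H) Z i V∋i))) ⟩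
    matchingSum (E H) (avoiding g)
      ∎)

  edgeTerms : ∀ p → ∑ (F p) (λ q → q α) ≡ Y p
  edgeTerms p =
    trans (∑-map _ (λ q → q α) (filterᵇ (λ S → V.lookup S i) (bigSubsets (L.lookup (E H) p))))
      (trans (∑-filterᵇ _ _ (bigSubsets (L.lookup (E H) p)))
        (∑-cong (bigSubsets (L.lookup (E H) p)) (λ S →
          cong (λ t → when (V.lookup S i) (+ (∣ S ∣ ∸ 1) * t))
               (η-∖ₛ (V H) (removeAt (E H) p) S α (All-removeAt (E H) p E⊑V)))))

  incidentOnly : ∀ p → when (V.lookup (L.lookup (E H) p) i) (Y p) ≡ Y p
  incidentOnly p with V.lookup (L.lookup (E H) p) i in e∋i
  ... | true  = refl
  ... | false = sym (∑-bigSubsets-∌ (L.lookup (E H) p) i _ e∋i)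

  coveringPart : covering (E H) g ≡ - Σps (concatMap F (incident H i)) α
  coveringPart = begin
    covering (E H) g
      ≡⟨ ∑-cong (L.allFin (length (E H))) (λ p → trans (∑-cong (bigSubsets (L.lookup (E H) p)) (λ S →
           trans (cong (when (V.lookup S i)) (ω-* S _)) (when-neg (V.lookup S i) _)))
           (sym (∑-neg _ (bigSubsets (L.lookup (E H) p))))) ⟩
    ∑[ p ← L.allFin (length (E H)) ] - Y p
      ≡⟨ ∑-neg Y (L.allFin (length (E H))) ⟨
    - ∑ (L.allFin (length (E H))) Y
      ≡⟨ cong -_ (∑-cong (L.allFin (length (E H))) (λ p →
           trans (cong (when (V.lookup (L.lookup (E H) p) i)) (edgeTerms p)) (incidentOnly p))) ⟨
    - (∑[ p ← L.allFin (length (E H)) ] when (V.lookup (L.lookup (E H) p) i) (∑ (F p) (λ q → q α)))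
      ≡⟨ cong -_ (trans (∑-concatMap (λ q → q α) F (incident H i))
                        (∑-filterᵇ _ _ (L.allFin (length (E H))))) ⟨
    - Σps (concatMap F (incident H i)) α
      ∎

IsHypergraph⇒⊑ : ∀ {n} (H : Hypergraph n) → IsHypergraph H → All (_⊑ V H) (E H)
IsHypergraph⇒⊑ H = All.map (λ {f} → ⊆⇒⊑ f (V H))

proposition5p8 : ∀ {n} (H : Hypergraph n) → IsHypergraph H →
    (i : Fin n) → i ∈ V H → (e : Fin (length (E H))) →
    -- (i)
    (η H ≈ₚ η (H ∖ₑ e) ⊖ Σps (map (λ S → scale (∣ S ∣ ∸ 1) (η ((H ∖ₑ e) ∖ₛ S)))
                                  (bigSubsets (L.lookup (E H) e))))
    -- (ii)
    × (η H ≈ₚ X i ⊛ η (H ∖ᵥ i)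
              ⊖ Σps (concatMap (λ e′ → map (λ S → scale (∣ S ∣ ∸ 1) (η ((H ∖ₑ e′) ∖ₛ S)))
                                           (filterᵇ (λ S → Data.Vec.lookup S i)
                                                    (bigSubsets (L.lookup (E H) e′))))
                               (incident H i)))
    -- (iii)
    × ((H₁ H₂ : Hypergraph n) → IsHypergraph H₁ → IsHypergraph H₂ → Empty (V H₁ ∩ V H₂) →
         η (H₁ ⊔ H₂) ≈ₚ η H₁ ⊛ η H₂)
    -- (iv)
    × (∂ i (η H) ≈ₚ η (H ∖ᵥ i))
proposition5p8 H isH i i∈V e =
    η-∖ₑ H E⊑V e
  , η-vertex H E⊑V i V∋i
  , (λ H₁ H₂ isH₁ isH₂ V₁∩V₂≡∅ →
       η-⊔ H₁ H₂ (IsHypergraph⇒⊑ H₁ isH₁) (IsHypergraph⇒⊑ H₂ isH₂)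
           (Empty⇒disjointᵇ (V H₁) (V H₂) V₁∩V₂≡∅))
  , η-∂ H E⊑V i V∋i
  where
  E⊑V = IsHypergraph⇒⊑ H isH
  V∋i = []=⇒lookup i∈V
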